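{- Define the map $G:\mathbb{Z}^2\to\mathbb{Z}^2$ by $$G((x,y))=\begin{cases}(y,\,-x-2y) & y\le 0,\\ (y,\,-x-2y+1) & y>0.\end{cases}$$ For every $(x,y)\in\mathbb{Z}^2$, the orbit of $(x,y)$ under $G$ is periodic.
   Context: $G$ is the map $(a_n,a_{n+1})\mapsto(a_{n+1},a_{n+2})$ for the sequence defined by $0\le a_{n+2}+(2-0)a_{n+1}+a_n<1$, i.e. the limit as $\eta\to+0$ of $0\le a_{n+2}+(2-\eta)a_{n+1}+a_n<1$; it is a bijection of $\mathbb{Z}^2$. -}

module Defs where

open import Data.Nat using (ℕ; zero; suc)
open import Data.Integer using (ℤ; _+_; _-_; -_; _≤_; _≤?_; 0ℤ; 1ℤ; +_)
open import Data.Product using (_×_; _,_)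
open import Relation.Nullary using (yes; no)

G : ℤ × ℤ → ℤ × ℤ
G (x , y) with y ≤? 0ℤ
... | yes _ = (y , (- x) - (y + y))
... | no  _ = (y , ((- x) - (y + y)) + 1ℤ)

iter : {A : Set} → (A → A) → ℕ → A → A
iter f zero    a = a
iter f (suc n) a = f (iter f n a)

{-# OPTIONS --safe #-}
-- Put s = x + y and energy (x , y) = s² - (x if x ≤ 0 else y). A direct computation gives
-- energy ∘ G = energy ∘ swap. If x and y lie on different sides of 0 the two energies are
-- equal; if both are ≤ 0 they lie in [s², (|s| + 1)²), and if both are > 0 in [(s - 1)², s²).
-- So energy q and energy (G q) always lie between the same two consecutive squares, and every
-- sublevel set {energy < m²} is G-invariant. Such a set is finite: |x| ≤ energy (x , y), and
-- |y| ≤ energy (y , x) < m² by the same comparison. As G is injective (the recurrence can be run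
-- backwards), by pigeonhole the orbit returns to its starting point.
module Submission where

open import Data.Fin.Base using (Fin; toℕ; fromℕ<; _↑ˡ_; _↑ʳ_; splitAt; combine; remQuot)
open import Data.Fin.Properties using (pigeonhole; toℕ-fromℕ<; splitAt-↑ˡ; splitAt-↑ʳ; remQuot-combine)
open import Data.Integer.Base
  using (ℤ; +_; -[1+_]; _+_; _-_; -_; _*_; _≤_; _<_; ∣_∣; 0ℤ; 1ℤ; +≤+; -≤+; +<+; -<+; nonNegative)
open import Data.Integer.Properties
open import Data.Integer.Tactic.RingSolver using (solve-∀)
open import Data.Nat.Base as ℕ using (ℕ; zero; suc; z≤n)
import Data.Nat.Properties as ℕ
open import Data.Product using (_×_; _,_; proj₁; proj₂; ∃-syntax; map)
open import Data.Sum using (_⊎_; inj₁; inj₂)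
open import Function.Definitions using (Injective)
open import Relation.Nullary using (yes; no)
open import Relation.Binary.PropositionalEquality

open import Defs

module _ {A : Set} (f : A → A) where

  iter-+ : ∀ m n a → iter f (m ℕ.+ n) a ≡ iter f m (iter f n a)
  iter-+ zero    n a = refl
  iter-+ (suc m) n a = cong f (iter-+ m n a)

  iter-injective : Injective _≡_ _≡_ f → ∀ n → Injective _≡_ _≡_ (iter f n)
  iter-injective f-injective zero    eq = eq
  iter-injective f-injective (suc n) eq = iter-injective f-injective n (f-injective eq)

  finite-orbit⇒periodic : Injective _≡_ _≡_ f → ∀ {K} (point : Fin K → A) a →
                          (∀ n → ∃[ k ] point k ≡ iter f n a) → ∃[ n ] iter f (suc n) a ≡ a
  finite-orbit⇒periodic f-injective {K} point a covered
    with i , j , i<j , same-point ← pigeonhole (ℕ.n<1+n K) (λ n → proj₁ (covered (toℕ n)))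
    with d , i+1+d≡j ← ℕ.m≤n⇒∃[o]m+o≡n i<j
    = d , iter-injective f-injective (toℕ i) (begin
        iter f (toℕ i) (iter f (suc d) a)  ≡⟨ iter-+ (toℕ i) (suc d) a ⟨
        iter f (toℕ i ℕ.+ suc d) a         ≡⟨ cong (λ n → iter f n a) i+1+d≡j′ ⟩
        iter f (toℕ j) a                   ≡⟨ proj₂ (covered (toℕ j)) ⟨
        point (proj₁ (covered (toℕ j)))    ≡⟨ cong point same-point ⟨
        point (proj₁ (covered (toℕ i)))    ≡⟨ proj₂ (covered (toℕ i)) ⟩
        iter f (toℕ i) a                   ∎)
    where
    open ≡-Reasoning
    i+1+d≡j′ : toℕ i ℕ.+ suc d ≡ toℕ j
    i+1+d≡j′ = trans (ℕ.+-suc (toℕ i) d) i+1+d≡j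

signed : ∀ {m n} → Fin m ⊎ Fin n → ℤ
signed (inj₁ i) = + toℕ i
signed (inj₂ i) = -[1+ toℕ i ]

fromFin± : ∀ n → Fin (n ℕ.+ n) → ℤ
fromFin± n i = signed (splitAt n i)

fromFin±-surjective : ∀ {n} z → ∣ z ∣ ℕ.< n → ∃[ i ] fromFin± n i ≡ z
fromFin±-surjective {n} (+ k) k<n =
  fromℕ< k<n ↑ˡ n , trans (cong signed (splitAt-↑ˡ n (fromℕ< k<n) n)) (cong +_ (toℕ-fromℕ< k<n))
fromFin±-surjective {n} -[1+ k ] 1+k<n =
  n ↑ʳ fromℕ< k<n , trans (cong signed (splitAt-↑ʳ n n (fromℕ< k<n))) (cong -[1+_] (toℕ-fromℕ< k<n))
  where
  k<n : k ℕ.< n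
  k<n = ℕ.<⇒≤ 1+k<n

grid : ∀ n → Fin ((n ℕ.+ n) ℕ.* (n ℕ.+ n)) → ℤ × ℤ
grid n k = map (fromFin± n) (fromFin± n) (remQuot (n ℕ.+ n) k)

grid-surjective : ∀ {n} x y → ∣ x ∣ ℕ.< n → ∣ y ∣ ℕ.< n → ∃[ k ] grid n k ≡ (x , y)
grid-surjective {n} x y ∣x∣<n ∣y∣<n
  with i , refl ← fromFin±-surjective x ∣x∣<n
  with j , refl ← fromFin±-surjective y ∣y∣<n
  = combine i j , cong (map (fromFin± n) (fromFin± n)) (remQuot-combine i j)

i+k≡j⇒i≤j : ∀ {i j} k → 0ℤ ≤ k → i + k ≡ j → i ≤ j
i+k≡j⇒i≤j {i} k 0≤k i+k≡j = subst (i ≤_) i+k≡j (i≤i+j i k {{nonNegative 0≤k}})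

1+i+k≡j⇒i<j : ∀ {i j} k → 0ℤ ≤ k → 1ℤ + i + k ≡ j → i < j
1+i+k≡j⇒i<j k 0≤k 1+i+k≡j = suc[i]≤j⇒i<j (i+k≡j⇒i≤j k 0≤k 1+i+k≡j)

0≤i*i : ∀ i → 0ℤ ≤ i * i
0≤i*i (+ n)      = subst (0ℤ ≤_) (pos-* n n) (+≤+ z≤n)
0≤i*i -[1+ n ]   = +≤+ z≤n

i≤i*i : ∀ i → i ≤ i * i
i≤i*i (+ zero)   = ≤-refl
i≤i*i (+ suc n)  = +≤+ (ℕ.m≤m*n (suc n) (suc n))
i≤i*i -[1+ n ]   = -≤+

i<[1+∣i∣]*[1+∣i∣] : ∀ i → i < + suc ∣ i ∣ * + suc ∣ i ∣
i<[1+∣i∣]*[1+∣i∣] (+ n)    = +<+ (ℕ.s≤s (ℕ.m≤m+n n _))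
i<[1+∣i∣]*[1+∣i∣] -[1+ n ] = -<+

i≤j⇒i*i≤j*j : ∀ {i j} → 0ℤ ≤ i → i ≤ j → i * i ≤ j * j
i≤j⇒i*i≤j*j {i} {j} 0≤i i≤j =
  ≤-trans (*-monoʳ-≤-nonNeg i {{nonNegative 0≤i}} i≤j)
          (*-monoˡ-≤-nonNeg j {{nonNegative (≤-trans 0≤i i≤j)}} i≤j)

square-bound-transfer : ∀ {a b t m} → 0ℤ ≤ t → 0ℤ ≤ m →
  t * t ≤ a → b < (1ℤ + t) * (1ℤ + t) → a < m * m → b < m * m
square-bound-transfer {a} {b} {t} {m} 0≤t 0≤m t*t≤a b<[1+t]² a<m*m =
  <-≤-trans b<[1+t]² (i≤j⇒i*i≤j*j (≤-trans 0≤t (i≤suc[i] t)) (i<j⇒suc[i]≤j t<m))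
  where
  t<m : t < m
  t<m = ≰⇒> λ m≤t → <-irrefl refl (≤-<-trans (≤-trans (i≤j⇒i*i≤j*j 0≤m m≤t) t*t≤a) a<m*m)

energy : ℤ × ℤ → ℤ
energy (x , y) with x ≤? 0ℤ
... | yes _ = (x + y) * (x + y) - x
... | no  _ = (x + y) * (x + y) - y

∣x∣≤energy : ∀ x y → + ∣ x ∣ ≤ energy (x , y)
∣x∣≤energy x y with x ≤? 0ℤ
... | yes x≤0 = ≤-trans (≤-reflexive +∣x∣≡-x)
                  (i+k≡j⇒i≤j ((x + y) * (x + y)) (0≤i*i (x + y)) (identity x y))
  where
  +∣x∣≡-x : + ∣ x ∣ ≡ - x
  +∣x∣≡-x = trans (cong +_ (sym (∣-i∣≡∣i∣ x))) (0≤i⇒+∣i∣≡i (neg-mono-≤ x≤0))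
  identity : ∀ x y → - x + (x + y) * (x + y) ≡ (x + y) * (x + y) - x
  identity = solve-∀
... | no x≰0 = ≤-trans (≤-reflexive (0≤i⇒+∣i∣≡i (<⇒≤ (≰⇒> x≰0))))
                 (i+k≡j⇒i≤j ((x + y) * (x + y) - (x + y)) (i≤j⇒0≤j-i (i≤i*i (x + y))) (identity x y))
  where
  identity : ∀ x y → x + ((x + y) * (x + y) - (x + y)) ≡ (x + y) * (x + y) - y
  identity = solve-∀

energy-swap-< : ∀ m x y → 0ℤ ≤ m → energy (x , y) < m * m → energy (y , x) < m * m
energy-swap-< m x y 0≤m with x ≤? 0ℤ | y ≤? 0ℤ
... | yes x≤0 | yes y≤0 =
  square-bound-transfer 0≤t 0≤m
    (i+k≡j⇒i≤j (- x) 0≤-x (lower x y))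
    (1+i+k≡j⇒i<j (t + - x) (+-mono-≤ 0≤t 0≤-x) (upper x y))
  where
  t : ℤ
  t = - x - y
  0≤-x : 0ℤ ≤ - x
  0≤-x = neg-mono-≤ x≤0
  0≤t : 0ℤ ≤ t
  0≤t = +-mono-≤ 0≤-x (neg-mono-≤ y≤0)
  lower : ∀ x y → (- x - y) * (- x - y) + - x ≡ (x + y) * (x + y) - x
  lower = solve-∀
  upper : ∀ x y → 1ℤ + ((y + x) * (y + x) - y) + (- x - y - x) ≡ (1ℤ + (- x - y)) * (1ℤ + (- x - y))
  upper = solve-∀
... | yes _ | no _ = subst (λ s → s * s - x < _) (+-comm x y)
... | no _ | yes _ = subst (λ s → s * s - y < _) (+-comm x y)
... | no x≰0 | no y≰0 =
  square-bound-transfer 0≤t 0≤m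
    (i+k≡j⇒i≤j (x + t) (+-mono-≤ 0≤x 0≤t) (lower x y))
    (1+i+k≡j⇒i<j (x - 1ℤ) 0≤x-1 (upper x y))
  where
  t : ℤ
  t = x - 1ℤ + y
  0≤x : 0ℤ ≤ x
  0≤x = <⇒≤ (≰⇒> x≰0)
  0≤x-1 : 0ℤ ≤ x - 1ℤ
  0≤x-1 = i≤j⇒0≤j-i (i<j⇒suc[i]≤j (≰⇒> x≰0))
  0≤t : 0ℤ ≤ t
  0≤t = +-mono-≤ 0≤x-1 (<⇒≤ (≰⇒> y≰0))
  lower : ∀ x y → (x - 1ℤ + y) * (x - 1ℤ + y) + (x + (x - 1ℤ + y)) ≡ (x + y) * (x + y) - y
  lower = solve-∀
  upper : ∀ x y → 1ℤ + ((y + x) * (y + x) - x) + (x - 1ℤ)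
                ≡ (1ℤ + (x - 1ℤ + y)) * (1ℤ + (x - 1ℤ + y))
  upper = solve-∀

G-shape : ∀ x y → G (x , y) ≡ (y , proj₂ (G (0ℤ , y)) - x)
G-shape x y with y ≤? 0ℤ
... | yes _ = cong (y ,_) (identity x (- (y + y)))
  where
  identity : ∀ x c → - x + c ≡ (0ℤ + c) - x
  identity = solve-∀
... | no  _ = cong (y ,_) (identity x (- (y + y)))
  where
  identity : ∀ x c → (- x + c) + 1ℤ ≡ ((0ℤ + c) + 1ℤ) - x
  identity = solve-∀

G⁻¹ : ℤ × ℤ → ℤ × ℤ
G⁻¹ (x , y) = (proj₂ (G (0ℤ , x)) - y , x)

G⁻¹-G : ∀ q → G⁻¹ (G q) ≡ q
G⁻¹-G (x , y) rewrite G-shape x y = cong (_, y) (identity (proj₂ (G (0ℤ , y))) x)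
  where
  identity : ∀ c x → c - (c - x) ≡ x
  identity = solve-∀

G-injective : Injective _≡_ _≡_ G
G-injective {p} {q} Gp≡Gq = trans (sym (G⁻¹-G p)) (trans (cong G⁻¹ Gp≡Gq) (G⁻¹-G q))

energy-G : ∀ x y → energy (G (x , y)) ≡ energy (y , x)
energy-G x y rewrite G-shape x y with y ≤? 0ℤ
... | yes _ = identity x y
  where
  identity : ∀ x y → (y + (0ℤ - (y + y) - x)) * (y + (0ℤ - (y + y) - x)) - y
                     ≡ (y + x) * (y + x) - y
  identity = solve-∀
... | no  _ = identity x y
  where
  identity : ∀ x y → (y + (0ℤ - (y + y) + 1ℤ - x)) * (y + (0ℤ - (y + y) + 1ℤ - x))
                       - (0ℤ - (y + y) + 1ℤ - x)
                     ≡ (y + x) * (y + x) - x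
  identity = solve-∀

energy-G-< : ∀ m q → energy q < + m * + m → energy (G q) < + m * + m
energy-G-< m (x , y) energy<m² =
  subst (_< + m * + m) (sym (energy-G x y)) (energy-swap-< (+ m) x y (+≤+ z≤n) energy<m²)

coordinates-< : ∀ m x y → energy (x , y) < + m * + m → ∣ x ∣ ℕ.< m ℕ.* m × ∣ y ∣ ℕ.< m ℕ.* m
coordinates-< m x y energy<m² =
  abs-< x (∣x∣≤energy x y) energy<m² ,
  abs-< y (∣x∣≤energy y x) (energy-swap-< (+ m) x y (+≤+ z≤n) energy<m²)
  where
  abs-< : ∀ z {e} → + ∣ z ∣ ≤ e → e < + m * + m → ∣ z ∣ ℕ.< m ℕ.* m
  abs-< z z≤e e<m² = drop‿+<+ (subst (+ ∣ z ∣ <_) (sym (pos-* m m)) (≤-<-trans z≤e e<m²))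

lemma2 : (p : ℤ × ℤ) → ∃[ n ] (iter G (suc n) p ≡ p)
lemma2 p = finite-orbit⇒periodic G G-injective (grid (m ℕ.* m)) p covered
  where
  m : ℕ
  m = suc ∣ energy p ∣
  bounded : ∀ n → energy (iter G n p) < + m * + m
  bounded zero    = i<[1+∣i∣]*[1+∣i∣] (energy p)
  bounded (suc n) = energy-G-< m (iter G n p) (bounded n)
  covered : ∀ n → ∃[ k ] grid (m ℕ.* m) k ≡ iter G n p
  covered n = let x , y = iter G n p; ∣x∣<m² , ∣y∣<m² = coordinates-< m x y (bounded n)
              in grid-surjective x y ∣x∣<m² ∣y∣<m²
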